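{- Let $q$ be a prime power, $n$ a positive integer coprime to $q$, and $\gamma\in\mathbb{Z}/n\mathbb{Z}$. Then $c_{n/q}(\gamma)$ is an equal-difference coset if and only if its primitive form $c_{n_\gamma/q}(\widetilde\gamma)$ is.
   Context: For $m$ coprime to $q$ and $\beta\in\mathbb{Z}/m\mathbb{Z}$, $c_{m/q}(\beta)=\{\beta,\beta q,\dots,\beta q^{\tau-1}\}\subseteq\mathbb{Z}/m\mathbb{Z}$ with $\tau$ least positive such that $\beta q^\tau\equiv\beta\pmod m$; it is of equal difference if $\tau\mid m$ and $c_{m/q}(\beta)=\{\beta,\beta+\frac m\tau,\dots,\beta+(\tau-1)\frac m\tau\}$ in $\mathbb{Z}/m\mathbb{Z}$ (one-element cosets included). For $\gamma\in\mathbb{Z}/n\mathbb{Z}$ (taken as an integer), set $\widetilde\gamma=\gamma/\gcd(\gamma,n)$ and $n_\gamma=n/\gcd(\gamma,n)$; the coset $c_{n_\gamma/q}(\widetilde\gamma)$ is the primitive form of $c_{n/q}(\gamma)$ (it does not depend on the chosen representative). -}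

module Defs where

open import Data.Nat using (ℕ; zero; suc; _+_; _*_; _^_; _≤_; _<_)
open import Data.Nat.Primality using (Prime)
open import Data.Nat.GCD using (gcd; gcd[m,n]∣m; gcd[m,n]∣n)
open import Data.Nat.Divisibility using (quotient)
open import Data.Product using (Σ; ∃; ∃-syntax; _×_)
open import Data.Sum using (_⊎_)
open import Relation.Binary.PropositionalEquality using (_≡_; _≢_)
open import Function.Bundles using (_⇔_)
open import Relation.Nullary using (¬_)

IsPrimePower : ℕ → Set
IsPrimePower q = ∃[ p ] ∃[ k ] (Prime p × 1 ≤ k × q ≡ p ^ k)

_≡_[mod_] : ℕ → ℕ → ℕ → Set
a ≡ b [mod m ] = ∃[ k ] (a ≡ b + k * m ⊎ b ≡ a + k * m)

IsCosetSize : (m q β τ : ℕ) → Set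
IsCosetSize m q β τ =
  0 < τ × (β * q ^ τ) ≡ β [mod m ] ×
  (∀ t → 0 < t → t < τ → ¬ ((β * q ^ t) ≡ β [mod m ]))

InCoset : (m q β τ x : ℕ) → Set
InCoset m q β τ x = ∃[ i ] (i < τ × x ≡ β * q ^ i [mod m ])

EqualDifference : (m q β : ℕ) → Set
EqualDifference m q β =
  ∃[ τ ] ∃[ d ] (IsCosetSize m q β τ × m ≡ τ * d ×
    (∀ x → x < m →
      (InCoset m q β τ x ⇔ (∃[ j ] (j < τ × x ≡ β + j * d [mod m ])))))

γ̃ : ℕ → ℕ → ℕ
γ̃ γ n = quotient (gcd[m,n]∣m γ n)

nγ : ℕ → ℕ → ℕ
nγ γ n = quotient (gcd[m,n]∣n γ n)

{-# OPTIONS --safe #-}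
module Submission where

open import Defs
open import Data.Nat using (ℕ; _<_)
open import Data.Nat.Coprimality using (Coprime)
open import Function.Bundles using (_⇔_; mk⇔; Equivalence)
open import Data.Nat.Base using (zero; suc; _+_; _*_; _^_; NonZero; >-nonZero; s≤s; z≤n)
open import Data.Nat.Properties
  using (+-comm; *-assoc; *-identityˡ; *-cancelʳ-≡; *-cancelʳ-<; *-monoˡ-<;
         m*n≢0; m*n≢0⇒m≢0; m*n≢0⇒n≢0)
open import Data.Nat.Divisibility
  using (_∣_; divides; ∣m∣n⇒∣m+n; ∣m+n∣m⇒∣n; n∣m*n; ∣n⇒∣m*n; ∣m⇒∣m*n; ∣n∣m%n⇒∣m)
open import Data.Nat.DivMod using (_%_; _/_; m≡m%n+[m/n]*n; m%n<n)
open import Data.Nat.GCD using (gcd; gcd[m,n]∣m; gcd[m,n]∣n)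
open import Data.Nat.Solver using (module +-*-Solver)
open import Data.Product using (∃-syntax; _×_; _,_)
open import Data.Sum using (inj₁; inj₂)
open import Relation.Binary.PropositionalEquality
  using (_≡_; refl; sym; trans; cong; subst; subst₂)
open import Function.Properties.Equivalence using () renaming (sym to ⇔-sym; trans to ⇔-trans)
open +-*-Solver using (solve; _:+_; _:*_; _:=_)
open Equivalence using (to; from)

-- With g = gcd(γ, n) we have n = n_γ g and γ = γ̃ g, and everything is invariant
-- under scaling modulus, coset leader and common difference by g: a congruence
-- mod m holds iff its g-fold holds mod m·g, and every element of c_{mg/q}(βg) and
-- of a progression βg + j·dg is a multiple of g, so no residue outside g·(ℤ/mℤ)
-- has to be matched.  The one extra point is that the common difference d of the
-- scaled coset is itself a multiple of g: βg + d lies in the progression, hence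
-- in the coset.

%-≡[mod] : ∀ x m .{{_ : NonZero m}} → (x % m) ≡ x [mod m ]
%-≡[mod] x m = x / m , inj₂ (m≡m%n+[m/n]*n x m)

≡[mod]-*-scale : ∀ {a b m} g .{{_ : NonZero g}} →
                 (a * g) ≡ b * g [mod m * g ] ⇔ a ≡ b [mod m ]
≡[mod]-*-scale {a} {b} {m} g = mk⇔ cancel scale
  where
  distrib : ∀ c k → (c + k * m) * g ≡ c * g + k * (m * g)
  distrib c k =
    solve 4 (λ c k m g → (c :+ k :* m) :* g := c :* g :+ k :* (m :* g)) refl c k m g

  cancel : (a * g) ≡ b * g [mod m * g ] → a ≡ b [mod m ]
  cancel (k , inj₁ e) = k , inj₁ (*-cancelʳ-≡ a (b + k * m) g (trans e (sym (distrib b k))))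
  cancel (k , inj₂ e) = k , inj₂ (*-cancelʳ-≡ b (a + k * m) g (trans e (sym (distrib a k))))

  scale : a ≡ b [mod m ] → (a * g) ≡ b * g [mod m * g ]
  scale (k , inj₁ e) = k , inj₁ (trans (cong (_* g) e) (distrib b k))
  scale (k , inj₂ e) = k , inj₂ (trans (cong (_* g) e) (distrib a k))

∣-resp-≡[mod] : ∀ {a b m g} → g ∣ m → a ≡ b [mod m ] → g ∣ b → g ∣ a
∣-resp-≡[mod] g∣m (k , inj₁ refl) g∣b = ∣m∣n⇒∣m+n g∣b (∣n⇒∣m*n k g∣m)
∣-resp-≡[mod] {a} {m = m} {g} g∣m (k , inj₂ refl) g∣a+km =
  ∣m+n∣m⇒∣n (subst (g ∣_) (+-comm a (k * m)) g∣a+km) (∣n⇒∣m*n k g∣m)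

-- InCoset m q β τ is definitionally InImage m τ (λ i → β * q ^ i), and EqualDifference
-- compares it with InImage m τ (λ j → β + j * d).
InImage : (m τ : ℕ) → (ℕ → ℕ) → ℕ → Set
InImage m τ f x = ∃[ i ] (i < τ × x ≡ f i [mod m ])

SameImage : (m τ : ℕ) → (f h : ℕ → ℕ) → Set
SameImage m τ f h = ∀ x → x < m → InImage m τ f x ⇔ InImage m τ h x

InImage-∣ : ∀ {m τ f x g} → g ∣ m → (∀ i → g ∣ f i) → InImage m τ f x → g ∣ x
InImage-∣ g∣m g∣f (i , _ , x≡fi) = ∣-resp-≡[mod] g∣m x≡fi (g∣f i)

InImage-*-scale : ∀ {m τ f f′} x g .{{_ : NonZero g}} → (∀ i → f′ i ≡ f i * g) →
                  InImage (m * g) τ f′ (x * g) ⇔ InImage m τ f x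
InImage-*-scale {m} x g f′≡fg = mk⇔
  (λ (i , i<τ , c) → i , i<τ , to (≡[mod]-*-scale g) (subst xg≡_ (f′≡fg i) c))
  (λ (i , i<τ , c) → i , i<τ , subst xg≡_ (sym (f′≡fg i)) (from (≡[mod]-*-scale g) c))
  where
  xg≡_ : ℕ → Set
  xg≡ y = (x * g) ≡ y [mod m * g ]

SameImage-*-scale : ∀ {m τ f f′ h h′} g .{{_ : NonZero g}} →
                    (∀ i → f′ i ≡ f i * g) → (∀ i → h′ i ≡ h i * g) →
                    SameImage (m * g) τ f′ h′ ⇔ SameImage m τ f h
SameImage-*-scale {m} {τ} {f} {f′} {h} {h′} g f′≡fg h′≡hg = mk⇔ down up
  where
  down : SameImage (m * g) τ f′ h′ → SameImage m τ f h
  down same x x<m = ⇔-trans (⇔-sym (InImage-*-scale x g f′≡fg))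
                     (⇔-trans (same (x * g) (*-monoˡ-< g x<m)) (InImage-*-scale x g h′≡hg))

  scaled-∣ : ∀ {k k′ : ℕ → ℕ} → (∀ i → k′ i ≡ k i * g) → ∀ i → g ∣ k′ i
  scaled-∣ {k} k′≡kg i = subst (g ∣_) (sym (k′≡kg i)) (n∣m*n (k i))

  lift : ∀ {k k′ l l′ : ℕ → ℕ} → (∀ i → k′ i ≡ k i * g) → (∀ i → l′ i ≡ l i * g) →
         (∀ x → x < m → InImage m τ k x → InImage m τ l x) →
         ∀ x → x < m * g → InImage (m * g) τ k′ x → InImage (m * g) τ l′ x
  lift {k} k′≡kg l′≡lg k⇒l x x<mg x∈k′ with InImage-∣ (n∣m*n m) (scaled-∣ {k} k′≡kg) x∈k′
  ... | divides y refl =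
    from (InImage-*-scale y g l′≡lg)
      (k⇒l y (*-cancelʳ-< g y m x<mg) (to (InImage-*-scale y g k′≡kg) x∈k′))

  up : SameImage m τ f h → SameImage (m * g) τ f′ h′
  up same x x<mg = mk⇔ (lift f′≡fg h′≡hg (λ y y<m → to (same y y<m)) x x<mg)
                       (lift h′≡hg f′≡fg (λ y y<m → from (same y y<m)) x x<mg)

coset-*-distrib : ∀ β q g i → (β * g) * q ^ i ≡ (β * q ^ i) * g
coset-*-distrib β q g i = solve 3 (λ β g Q → (β :* g) :* Q := (β :* Q) :* g) refl β g (q ^ i)

progression-*-distrib : ∀ β d g j → β * g + j * (d * g) ≡ (β + j * d) * g
progression-*-distrib = solve 4 (λ β d g j → β :* g :+ j :* (d :* g) := (β :+ j :* d) :* g) refl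

IsCosetSize-*-scale : ∀ m q β τ g .{{_ : NonZero g}} →
                      IsCosetSize (m * g) q (β * g) τ ⇔ IsCosetSize m q β τ
IsCosetSize-*-scale m q β τ g = mk⇔
  (λ (τ>0 , periodic , minimal) →
     τ>0 , to (period τ) periodic , λ t t>0 t<τ p → minimal t t>0 t<τ (from (period t) p))
  (λ (τ>0 , periodic , minimal) →
     τ>0 , from (period τ) periodic , λ t t>0 t<τ p → minimal t t>0 t<τ (to (period t) p))
  where
  period : ∀ t → ((β * g) * q ^ t) ≡ β * g [mod m * g ] ⇔ (β * q ^ t) ≡ β [mod m ]
  period t = subst (λ y → y ≡ β * g [mod m * g ] ⇔ (β * q ^ t) ≡ β [mod m ])
                   (sym (coset-*-distrib β q g t)) (≡[mod]-*-scale g)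

-- τ = 1 forces d = m; for τ ≥ 2, (β + d) mod m is the second term of the progression.
commonDifference-∣ : ∀ {m τ d g β f} .{{_ : NonZero m}} →
                     g ∣ m → g ∣ β → (∀ i → g ∣ f i) →
                     0 < τ → m ≡ τ * d → SameImage m τ f (λ j → β + j * d) → g ∣ d
commonDifference-∣ {τ = suc zero} {d} {g} g∣m _ _ _ m≡d _ =
  subst (g ∣_) (trans m≡d (*-identityˡ d)) g∣m
commonDifference-∣ {m} {suc (suc _)} {d} {g} {β} g∣m g∣β g∣f _ _ same =
  ∣m+n∣m⇒∣n (subst (g ∣_) (cong (β +_) (*-identityˡ d)) g∣β+1d) g∣β
  where
  second : InImage m _ (λ j → β + j * d) ((β + 1 * d) % m)
  second = 1 , s≤s (s≤s z≤n) , %-≡[mod] (β + 1 * d) m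

  g∣β+1d : g ∣ β + 1 * d
  g∣β+1d = ∣n∣m%n⇒∣m g∣m (InImage-∣ g∣m g∣f (from (same _ (m%n<n _ m)) second))

EqualDifference-*-scale : ∀ m q β g .{{_ : NonZero m}} .{{_ : NonZero g}} →
                          EqualDifference (m * g) q (β * g) ⇔ EqualDifference m q β
EqualDifference-*-scale m q β g = mk⇔ down up
  where
  instance
    mg≢0 : NonZero (m * g)
    mg≢0 = m*n≢0 m g

  down : EqualDifference (m * g) q (β * g) → EqualDifference m q β
  down (τ , d , size@(τ>0 , _) , mg≡τd , same)
    with commonDifference-∣ (n∣m*n m) (n∣m*n β) (λ i → ∣m⇒∣m*n (q ^ i) (n∣m*n β))
                            τ>0 mg≡τd same
  ... | divides d′ refl =
    τ , d′ , to (IsCosetSize-*-scale m q β τ g) size ,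
    *-cancelʳ-≡ m (τ * d′) g (trans mg≡τd (sym (*-assoc τ d′ g))) ,
    to (SameImage-*-scale g (coset-*-distrib β q g) (progression-*-distrib β d′ g)) same

  up : EqualDifference m q β → EqualDifference (m * g) q (β * g)
  up (τ , d , size , m≡τd , same) =
    τ , d * g , from (IsCosetSize-*-scale m q β τ g) size ,
    trans (cong (_* g) m≡τd) (*-assoc τ d g) ,
    from (SameImage-*-scale g (coset-*-distrib β q g) (progression-*-distrib β d g)) same

lemma3p2 : (q n γ : ℕ) → IsPrimePower q → 0 < n → Coprime n q → γ < n →
           EqualDifference n q γ ⇔ EqualDifference (nγ γ n) q (γ̃ γ n)
lemma3p2 q n γ _ n>0 _ _ =
  subst₂ (λ N Γ → EqualDifference N q Γ ⇔ EqualDifference (nγ γ n) q (γ̃ γ n))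
         (sym n≡nγ*g) (sym γ≡γ̃*g)
         (EqualDifference-*-scale (nγ γ n) q (γ̃ γ n) (gcd γ n)
            {{m*n≢0⇒m≢0 (nγ γ n)}} {{m*n≢0⇒n≢0 (nγ γ n)}})
  where
  n≡nγ*g : n ≡ nγ γ n * gcd γ n
  n≡nγ*g = _∣_.equality (gcd[m,n]∣n γ n)

  γ≡γ̃*g : γ ≡ γ̃ γ n * gcd γ n
  γ≡γ̃*g = _∣_.equality (gcd[m,n]∣m γ n)

  instance
    n≢0 : NonZero (nγ γ n * gcd γ n)
    n≢0 = subst NonZero n≡nγ*g (>-nonZero n>0)
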